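{- Let $p$ be a positive integer and let $G$ be a simple graph of order $p+5$ not containing $B_p$ as a subgraph. If $x$ and $y$ are two distinct vertices with $\deg_{\overline{G}}(x)=\deg_{\overline{G}}(y)=2$ and the distance between them in $\overline{G}$ is at most $2$, then $x$ and $y$ are adjacent in $\overline{G}$.
   Context: The book $B_p$ is the graph consisting of $p$ triangles sharing a common edge. $\overline{G}$ denotes the complement of $G$. -}

module Defs where

open import Data.Nat using (ℕ; zero; suc; _+_)
open import Data.Bool using (Bool; true; false; not; _∧_; if_then_else_)
open import Data.Bool.Properties using (∧-comm)
open import Data.Fin using (Fin)
open import Data.Fin.Properties using (_≟_)
open import Data.List using (List; map)
open import Data.Nat.ListAction using (sum)
open import Data.List using () renaming (allFin to allFinL)
open import Data.Product using (Σ; _×_; _,_; ∃)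
open import Data.Sum using (_⊎_)
open import Function.Definitions using (Injective)
open import Relation.Nullary using (¬_; yes; no)
open import Relation.Nullary.Decidable using (⌊_⌋)
open import Relation.Binary.PropositionalEquality using (_≡_; refl; sym; cong; cong₂)

record SimpleGraph (n : ℕ) : Set where
  field
    adj    : Fin n → Fin n → Bool
    adj-sym : ∀ x y → adj x y ≡ adj y x
    adj-irr : ∀ x → adj x x ≡ false
open SimpleGraph public

Adj : ∀ {n} → SimpleGraph n → Fin n → Fin n → Set
Adj G x y = adj G x y ≡ true

degree : ∀ {n} → SimpleGraph n → Fin n → ℕ
degree {n} G x = sum (map (λ v → if adj G x v then 1 else 0) (allFinL n))

private
  neq : ∀ {n} → Fin n → Fin n → Bool
  neq x y = not ⌊ x ≟ y ⌋

  neq-sym : ∀ {n} (x y : Fin n) → neq x y ≡ neq y x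
  neq-sym x y with x ≟ y | y ≟ x
  ... | yes _ | yes _ = refl
  ... | no _  | no _  = refl
  ... | yes p | no q  with q (sym p)
  ... | ()
  neq-sym x y | no q | yes p with q (sym p)
  ... | ()

  neq-irr : ∀ {n} (x : Fin n) → neq x x ≡ false
  neq-irr x with x ≟ x
  ... | yes _ = refl
  ... | no q with q refl
  ... | ()

complement : ∀ {n} → SimpleGraph n → SimpleGraph n
complement G = record
  { adj = λ x y → not (adj G x y) ∧ neq x y
  ; adj-sym = λ x y → cong₂ (λ a b → not a ∧ b) (adj-sym G x y) (neq-sym x y)
  ; adj-irr = λ x → trans' (cong (not (adj G x x) ∧_) (neq-irr x)) (∧-comm (not (adj G x x)) false)
  }
  where
    trans' : ∀ {a b c : Bool} → a ≡ b → b ≡ c → a ≡ c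
    trans' refl refl = refl

-- The book B_p: p triangles sharing a common edge.  G contains B_p as a
-- (not necessarily induced) subgraph iff there are adjacent vertices u, v
-- and p distinct vertices w_1..w_p each adjacent to both u and v
-- (the w_i are automatically distinct from u and v, as G is loopless).
ContainsBook : ∀ {n} → ℕ → SimpleGraph n → Set
ContainsBook {n} p G =
  Σ (Fin n) λ u → Σ (Fin n) λ v → Adj G u v ×
    Σ (Fin p → Fin n) λ w → Injective _≡_ _≡_ w ×
      (∀ i → Adj G u (w i) × Adj G v (w i))

DistAtMost2 : ∀ {n} → SimpleGraph n → Fin n → Fin n → Set
DistAtMost2 {n} G x y = x ≡ y ⊎ Adj G x y ⊎ (Σ (Fin n) λ z → Adj G x z × Adj G z y)

-- If x and y were adjacent in G, every vertex other than x, y and their at most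
-- four neighbours in the complement would be a common G-neighbour of x and y.
-- A common complement-neighbour z of x and y is counted twice among those four,
-- so at most 5 of the p + 5 vertices are excluded, leaving p common neighbours:
-- together with the edge xy they form a book B_p.
module Submission where

open import Defs
open import Data.Bool using (Bool; true; false; not; _∧_; if_then_else_)
open import Data.Bool.Properties using (∧-conicalˡ; ∧-conicalʳ; T-≡)
open import Data.Empty using (⊥-elim)
open import Data.Fin using (Fin; zero; suc; inject≤)
open import Data.Fin.Properties using (_≟_; inject≤-injective)
open import Data.List using (List; []; _∷_; map; length; filter; lookup; allFin)
open import Data.List.Properties using (length-tabulate)
open import Data.List.Membership.Propositional using (_∈_)
open import Data.List.Membership.Propositional.Properties using (∈-allFin; ∈-lookup)
open import Data.List.Relation.Unary.All as All using (All; []; _∷_)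
open import Data.List.Relation.Unary.All.Properties using (all-filter)
open import Data.List.Relation.Unary.Any using (here; there)
open import Data.List.Relation.Unary.AllPairs using (_∷_)
open import Data.List.Relation.Unary.Unique.Propositional using (Unique)
import Data.List.Relation.Unary.Unique.Propositional.Properties as Unique
open import Data.Nat using (ℕ; _+_; _≤_; z≤n; s≤s; s≤s⁻¹)
open import Data.Nat.ListAction using (sum)
open import Data.Nat.Properties
  using (≤-refl; ≤-trans; +-mono-≤; +-monoˡ-≤; +-monoʳ-≤; +-cancelʳ-≤; +-comm; m≤n+m; +-suc;
         +-commutativeSemigroup; module ≤-Reasoning)
open import Algebra.Properties.CommutativeSemigroup +-commutativeSemigroup using (interchange)
open import Data.Product using (Σ; _×_; _,_)
open import Data.Sum using (_⊎_; inj₁; inj₂)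
open import Function using (_∘_)
open import Function.Bundles using (Equivalence)
open import Function.Definitions using (Injective)
open import Relation.Nullary using (¬_; yes; no)
open import Relation.Nullary.Decidable using (⌊_⌋; T?)
open import Relation.Binary.Definitions using (DecidableEquality)
open import Relation.Binary.PropositionalEquality
  using (_≡_; refl; sym; trans; cong; cong₂; subst; module ≡-Reasoning)

indicator : Bool → ℕ
indicator b = if b then 1 else 0

indicator≤1 : ∀ b → indicator b ≤ 1
indicator≤1 true  = ≤-refl
indicator≤1 false = z≤n

module _ {a} {A : Set a} where

  count : (A → Bool) → List A → ℕ
  count P xs = sum (map (indicator ∘ P) xs)

  sum-map-mono : {f g : A → ℕ} → (∀ v → f v ≤ g v) → ∀ xs → sum (map f xs) ≤ sum (map g xs)
  sum-map-mono f≤g []       = z≤n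
  sum-map-mono f≤g (v ∷ xs) = +-mono-≤ (f≤g v) (sum-map-mono f≤g xs)

  sum-map-+ : (f g : A → ℕ) → ∀ xs →
    sum (map (λ v → f v + g v) xs) ≡ sum (map f xs) + sum (map g xs)
  sum-map-+ f g []       = refl
  sum-map-+ f g (v ∷ xs) = begin
    f v + g v + sum (map (λ v → f v + g v) xs)        ≡⟨ cong (f v + g v +_) (sum-map-+ f g xs) ⟩
    f v + g v + (sum (map f xs) + sum (map g xs))     ≡⟨ interchange (f v) (g v) _ _ ⟩
    f v + sum (map f xs) + (g v + sum (map g xs))     ∎
    where open ≡-Reasoning

  count+count-not : (P : A → Bool) → ∀ xs → count P xs + count (not ∘ P) xs ≡ length xs
  count+count-not P []       = refl
  count+count-not P (v ∷ xs) with P v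
  ... | true  = cong (1 +_) (count+count-not P xs)
  ... | false = trans (+-suc (count P xs) _) (cong (1 +_) (count+count-not P xs))

  count≡length-filter : (P : A → Bool) → ∀ xs → count P xs ≡ length (filter (T? ∘ P) xs)
  count≡length-filter P []       = refl
  count≡length-filter P (v ∷ xs) with P v
  ... | true  = cong (1 +_) (count≡length-filter P xs)
  ... | false = count≡length-filter P xs

  lookup-injective : ∀ {xs : List A} → Unique xs → ∀ {i j} → lookup xs i ≡ lookup xs j → i ≡ j
  lookup-injective (_ ∷ _)       {zero}  {zero}  _ = refl
  lookup-injective (v≢xs ∷ _)    {zero}  {suc j} e = ⊥-elim (All.lookup v≢xs (∈-lookup j) e)
  lookup-injective (v≢xs ∷ _)    {suc i} {zero}  e = ⊥-elim (All.lookup v≢xs (∈-lookup i) (sym e))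
  lookup-injective (_ ∷ unique)  {suc i} {suc j} e = cong suc (lookup-injective unique e)

  distinct-witnesses : (P : A → Bool) → ∀ {xs k} → Unique xs → k ≤ count P xs →
    Σ (Fin k → A) λ w → Injective _≡_ _≡_ w × (∀ i → P (w i) ≡ true)
  distinct-witnesses P {xs} unique k≤count = w , w-injective , w-satisfies
    where
    ws = filter (T? ∘ P) xs
    k≤|ws| = subst (_ ≤_) (count≡length-filter P xs) k≤count
    w = λ i → lookup ws (inject≤ i k≤|ws|)
    w-injective : Injective _≡_ _≡_ w
    w-injective e = inject≤-injective _ _ _ _ (lookup-injective (Unique.filter⁺ (T? ∘ P) unique) e)
    w-satisfies : ∀ i → P (w i) ≡ true
    w-satisfies i = Equivalence.to T-≡ (All.lookup (all-filter (T? ∘ P) xs) (∈-lookup _))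

  module _ (_≟ᴬ_ : DecidableEquality A) where

    count-≟-∉ : ∀ {x xs} → All (λ v → ¬ x ≡ v) xs → count (λ v → ⌊ x ≟ᴬ v ⌋) xs ≡ 0
    count-≟-∉ []                     = refl
    count-≟-∉ {x} {v ∷ _} (x≢v ∷ x∉) with x ≟ᴬ v
    ... | yes x≡v = ⊥-elim (x≢v x≡v)
    ... | no _    = count-≟-∉ x∉

    count-≟-unique : ∀ {x xs} → Unique xs → x ∈ xs → count (λ v → ⌊ x ≟ᴬ v ⌋) xs ≡ 1
    count-≟-unique {x} (x≢xs ∷ _) (here refl) with x ≟ᴬ x
    ... | yes _  = cong (1 +_) (count-≟-∉ x≢xs)
    ... | no x≢x = ⊥-elim (x≢x refl)
    count-≟-unique {x} {v ∷ _} (v≢xs ∷ unique) (there x∈xs) with x ≟ᴬ v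
    ... | yes refl = ⊥-elim (All.lookup v≢xs x∈xs refl)
    ... | no _     = count-≟-unique unique x∈xs

count-≟-allFin : ∀ {n} (x : Fin n) → count (λ v → ⌊ x ≟ v ⌋) (allFin n) ≡ 1
count-≟-allFin {n} x = count-≟-unique _≟_ (Unique.allFin⁺ n) (∈-allFin x)

module _ {n : ℕ} (G : SimpleGraph n) where

  adjBoth : Fin n → Fin n → Fin n → Bool
  adjBoth x y v = adj G x v ∧ adj G y v

  book : ∀ {p x y} → Adj G x y → p ≤ count (adjBoth x y) (allFin n) → ContainsBook p G
  book {p} {x} {y} x~y p≤common with distinct-witnesses (adjBoth x y) (Unique.allFin⁺ n) p≤common
  ... | w , w-injective , w-common =
    x , y , x~y , w , w-injective , λ i → ∧-conicalˡ _ _ (w-common i) , ∧-conicalʳ _ _ (w-common i)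

  adj⊎complement-adj : ∀ {x y} → ¬ x ≡ y → Adj G x y ⊎ Adj (complement G) x y
  adj⊎complement-adj {x} {y} x≢y with adj G x y | x ≟ y
  ... | true  | _       = inj₁ refl
  ... | false | yes x≡y = ⊥-elim (x≢y x≡y)
  ... | false | no _    = inj₂ refl

-- With a, b read as v ~ x, v ~ y in G and ex, ey as v ≡ x, v ≡ y: a vertex that
-- is not a common neighbour of x and y is x, y, or a complement-neighbour of x or y.
not-adjBoth-covered : ∀ a b ex ey →
  indicator (not (a ∧ b)) ≤ indicator ex + indicator ey + indicator (not a ∧ not ex) + indicator (not b ∧ not ey)
not-adjBoth-covered true  true  ex    ey    = z≤n
not-adjBoth-covered false b     true  ey    = s≤s z≤n
not-adjBoth-covered false b     false true  = s≤s z≤n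
not-adjBoth-covered false b     false false = s≤s z≤n
not-adjBoth-covered true  false true  ey    = s≤s z≤n
not-adjBoth-covered true  false false true  = s≤s z≤n
not-adjBoth-covered true  false false false = s≤s z≤n

module _ {n : ℕ} (G : SimpleGraph n) where

  private
    Ḡ = complement G

  commonNeighbours-lowerBound : ∀ {x y z} → Adj Ḡ x z → Adj Ḡ z y →
    n ≤ count (adjBoth G x y) (allFin n) + (1 + degree Ḡ x + degree Ḡ y)
  commonNeighbours-lowerBound {x} {y} {z} x~z z~y = begin
    n                                      ≡⟨ sym (length-tabulate {n = n} (λ v → v)) ⟩
    length V                               ≡⟨ sym (count+count-not common V) ⟩
    count common V + count (not ∘ common) V ≤⟨ +-monoʳ-≤ (count common V) excluded ⟩
    count common V + (1 + degree Ḡ x + degree Ḡ y) ∎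
    where
    open ≤-Reasoning
    V = allFin n
    common = adjBoth G x y
    is : Fin n → Fin n → Bool
    is u v = ⌊ u ≟ v ⌋
    I : (Fin n → Bool) → Fin n → ℕ
    I P = indicator ∘ P
    pointwise : ∀ v → I (is z) v + I (not ∘ common) v ≤ I (is x) v + I (is y) v + I (adj Ḡ x) v + I (adj Ḡ y) v
    pointwise v with z ≟ v
    pointwise v | no _ = not-adjBoth-covered (adj G x v) (adj G y v) (is x v) (is y v)
    pointwise z | yes refl rewrite x~z | trans (adj-sym Ḡ y z) z~y =
      subst (_≤ I (is x) z + I (is y) z + 1 + 1) (+-comm (I (not ∘ common) z) 1)
        (+-monoˡ-≤ 1 (≤-trans (indicator≤1 _) (m≤n+m 1 _)))
    excluded : count (not ∘ common) V ≤ 1 + degree Ḡ x + degree Ḡ y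
    excluded = s≤s⁻¹ (begin
      1 + count (not ∘ common) V                     ≡⟨ cong (_+ count (not ∘ common) V) (sym (count-≟-allFin z)) ⟩
      count (is z) V + count (not ∘ common) V        ≡⟨ sym (sum-map-+ _ _ V) ⟩
      sum (map (λ v → I (is z) v + I (not ∘ common) v) V)
        ≤⟨ sum-map-mono pointwise V ⟩
      sum (map (λ v → I (is x) v + I (is y) v + I (adj Ḡ x) v + I (adj Ḡ y) v) V)
        ≡⟨ sum-map-+ _ _ V ⟩
      sum (map (λ v → I (is x) v + I (is y) v + I (adj Ḡ x) v) V) + degree Ḡ y
        ≡⟨ cong (_+ degree Ḡ y) (sum-map-+ _ _ V) ⟩
      sum (map (λ v → I (is x) v + I (is y) v) V) + degree Ḡ x + degree Ḡ y
        ≡⟨ cong (λ s → s + degree Ḡ x + degree Ḡ y) (sum-map-+ _ _ V) ⟩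
      count (is x) V + count (is y) V + degree Ḡ x + degree Ḡ y
        ≡⟨ cong₂ (λ a b → a + b + degree Ḡ x + degree Ḡ y) (count-≟-allFin x) (count-≟-allFin y) ⟩
      2 + degree Ḡ x + degree Ḡ y ∎)

lemma9 : (p : ℕ) → 1 ≤ p → (G : SimpleGraph (p + 5)) → ¬ ContainsBook p G →
    (x y : Fin (p + 5)) → ¬ x ≡ y →
    degree (complement G) x ≡ 2 → degree (complement G) y ≡ 2 →
    DistAtMost2 (complement G) x y →
    Adj (complement G) x y
lemma9 p _ G ¬book x y x≢y _  _  (inj₁ x≡y)        = ⊥-elim (x≢y x≡y)
lemma9 p _ G ¬book x y x≢y _  _  (inj₂ (inj₁ x~y)) = x~y
lemma9 p _ G ¬book x y x≢y dx dy (inj₂ (inj₂ (z , x~z , z~y))) with adj⊎complement-adj G x≢y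
... | inj₂ x~y = x~y
... | inj₁ x-y = ⊥-elim (¬book (book G x-y p≤common))
  where
  p≤common : p ≤ count (adjBoth G x y) (allFin (p + 5))
  p≤common = +-cancelʳ-≤ 5 p _
    (subst (λ d → p + 5 ≤ count (adjBoth G x y) (allFin (p + 5)) + d) (cong₂ (λ a b → 1 + a + b) dx dy)
      (commonNeighbours-lowerBound G x~z z~y))
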